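{- Let $n$ be a positive integer, $U_n=\{(\lambda,s,t): |\lambda|=n,\ 1\le s\le D(\lambda),\ 1\le t\le\lambda_1\}$, and $Q_n\subseteq U_n$ the set of doubly marked partitions of $n$. Let $(\lambda,s,t)\in U_n\setminus Q_n$ and let $(\mu,a,b)=\tau(\lambda,s,t)$, where $\tau$ is the map defined below. Then $(\mu,a,b)\in U_n$; moreover, if $a=1$ then $\mu'_b>s(\mu')$.
   Context: Partitions are written with weakly decreasing positive parts $\lambda=(\lambda_1,\dots,\lambda_\ell)$; $\lambda'$ is the conjugate (so $\lambda'_s$ is the number of parts $\ge s$), $D(\lambda)$ is the side length of the Durfee square, and $s(\lambda)$ is the smallest part. A doubly marked partition of $n$ is a triple $(\lambda,s,t)$ with $|\lambda|=n$, $1\le s\le D(\lambda)$, $s\le t\le\lambda_1$, $\lambda'_s=\lambda'_t$. Thus $(\lambda,s,t)\in U_n\setminus Q_n$ means $1\le s\le D(\lambda)$, $1\le t\le\lambda_1$, and either $t<s$ or $\lambda'_s>\lambda'_t$. The map $\tau$ on $U_n\setminus Q_n$: let $p$ be the maximum integer with $\lambda'_p=\lambda'_s$. Define $$\delta=(\lambda_1-p+s-1,\ \dots,\ \lambda_{\lambda'_s}-p+s-1,\ \lambda_{\lambda'_s+1},\ \dots,\ \lambda_\ell)$$ (discarding zero parts, and with $\delta_i=0$ beyond its length). Let $a$ be the minimum integer such that $\delta_a<\lambda'_s$, and let $$\mu=(\delta_1,\dots,\delta_{a-1},\lambda'_s,\lambda'_{s+1},\dots,\lambda'_p,\delta_a,\delta_{a+1},\dots),$$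 i.e. $\mu$ is obtained from $\delta$ by inserting $p-s+1$ parts equal to $\lambda'_s$. If $t<s$ set $b=t$; if $\lambda'_s>\lambda'_t$ set $b=t-p+s-1$. Then $\tau(\lambda,s,t)=(\mu,a,b)$. -}

module Defs where

open import Data.Nat using (ℕ; zero; suc; _+_; _∸_; _≤_; _<_; _>_; _≤?_; _<?_; _≟_; _⊓_)
open import Data.Bool using (Bool; true; false; if_then_else_)
open import Data.List using (List; []; _∷_; length; filter; map; take; drop; upTo; foldr; _++_)
open import Data.Nat.ListAction using (sum)
open import Data.List.Relation.Unary.All using (All)
open import Data.List.Relation.Unary.Linked using (Linked)
open import Data.Product using (_×_)
open import Relation.Nullary using (¬_; does)
open import Relation.Binary.PropositionalEquality using (_≡_)

IsPartition : List ℕ → Set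
IsPartition la = All (λ x → 0 < x) la × Linked (λ x y → y ≤ x) la

size : List ℕ → ℕ
size = sum

-- λ_i (1-indexed), 0 beyond the length (and for i = 0).
part : List ℕ → ℕ → ℕ
part []       _             = 0
part (x ∷ xs) zero          = 0
part (x ∷ xs) (suc zero)    = x
part (x ∷ xs) (suc (suc i)) = part xs (suc i)

conj : List ℕ → ℕ → ℕ
conj la s = length (filter (s ≤?_) la)

conjugate : List ℕ → List ℕ
conjugate la = map (λ j → conj la (suc j)) (upTo (part la 1))

-- smallest part s(λ) (0 for the empty partition)
smallestPart : List ℕ → ℕ
smallestPart []       = 0
smallestPart (x ∷ xs) = foldr _⊓_ x xs

-- greatest P N : the greatest k with 1 ≤ k ≤ N and P k (0 if none)
greatest : (ℕ → Bool) → ℕ → ℕ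
greatest P zero    = 0
greatest P (suc N) = if P (suc N) then suc N else greatest P N

-- least P k f : the least k' with k ≤ k' ≤ k + f - 1 and P k' (falls back to k + f)
least : (ℕ → Bool) → ℕ → ℕ → ℕ
least P k zero    = k
least P k (suc f) = if P k then k else least P (suc k) f

-- Durfee square side: the maximal d with λ_d ≥ d (d ≤ length λ necessarily)
durfee : List ℕ → ℕ
durfee la = greatest (λ d → does (d ≤? part la d)) (length la)

InU : ℕ → List ℕ → ℕ → ℕ → Set
InU n la s t = IsPartition la × size la ≡ n × 1 ≤ s × s ≤ durfee la × 1 ≤ t × t ≤ part la 1

InQ : ℕ → List ℕ → ℕ → ℕ → Set
InQ n la s t = InU n la s t × s ≤ t × conj la s ≡ conj la t

-- The map τ.
-- p : the maximal integer with λ'_p = λ'_s (such p satisfy p ≤ λ_1 since λ'_s ≥ 1)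
tau-p : List ℕ → ℕ → ℕ
tau-p la s = greatest (λ j → does (conj la j ≟ conj la s)) (part la 1)

tau-δ : List ℕ → ℕ → List ℕ
tau-δ la s = filter (λ x → 0 <? x)
  (map (λ x → x ∸ (p ∸ s + 1)) (take (conj la s) la) ++ drop (conj la s) la)
  where p = tau-p la s

-- a : the minimal integer (≥ 1) with δ_a < λ'_s (exists: δ_{length δ + 1} = 0 < λ'_s)
tau-a : List ℕ → ℕ → ℕ
tau-a la s = least (λ k → does (part δ k <? conj la s)) 1 (length δ + 1)
  where δ = tau-δ la s

tau-μ : List ℕ → ℕ → List ℕ
tau-μ la s = take (a ∸ 1) δ ++ map (λ j → conj la (s + j)) (upTo (p ∸ s + 1)) ++ drop (a ∸ 1) δ
  where
  p = tau-p la s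
  δ = tau-δ la s
  a = tau-a la s

tau-b : List ℕ → ℕ → ℕ → ℕ
tau-b la s t = if does (t <? s) then t else t ∸ tau-p la s + s ∸ 1

module Submission where

-- Write c = λ'_s and k = p − s + 1.
-- (1) Galois connection j ≤ λ_i ⇔ i ≤ λ'_j for decreasing λ: with the Durfee
--     bound s ≤ λ_s it gives s ≤ c, λ_c = p, λ_{c+1} < s, and λ'_j = c for
--     all s ≤ j ≤ p.
-- (2) Two list surgeries preserve decreasing lists: shaving k off the first
--     c parts (allowed since λ_c − k = s − 1 ≥ λ_{c+1}) yields δ and lowers
--     the sum by c·k; inserting k parts c before the first δ_a < c yields μ
--     and restores it; the inserted part μ_a = c ≥ a gives a ≤ D(μ).
-- (3) b ∈ [1, δ_1]: for t < s since t ≤ s − 1 = δ_c; for t ≥ s because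
--     (λ, s, t) ∉ Q_n forces t > p, so b = t − k ≤ λ_1 − k = δ_1.
-- (4) If a = 1, μ is the block c^k on top of δ: column c of μ has length k,
--     column b has length > k.

open import Defs
open import Data.Nat
open import Data.Nat.Properties
open import Data.Bool using (Bool; true; false; if_then_else_)
open import Data.List using (List; []; _∷_; length; filter; map; take; drop; upTo; applyUpTo; foldr; _++_; replicate)
open import Data.List.Properties using (filter-accept; filter-reject; length-map; length-upTo; length-take; length-replicate; length-++; take++drop≡id)
open import Data.Nat.ListAction using (sum)
open import Data.Nat.ListAction.Properties using (sum-++)
open import Data.List.Relation.Unary.All using (All; []; _∷_)
import Data.List.Relation.Unary.All.Properties as All
open import Data.List.Relation.Unary.Linked using (Linked; []; [-]; _∷_)
open import Data.Product using (_×_; _,_; proj₁; proj₂)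
open import Relation.Nullary using (¬_; Dec; yes; no; does)
open import Relation.Nullary.Decidable using (dec-true; dec-false)
open import Relation.Binary.PropositionalEquality
open import Data.Empty using (⊥; ⊥-elim)
open import Algebra.Properties.CommutativeSemigroup +-commutativeSemigroup using (interchange; xy∙z≈xz∙y; x∙yz≈y∙xz; x∙yz≈xz∙y)

at : List ℕ → ℕ → ℕ
at []       _       = 0
at (x ∷ xs) zero    = x
at (x ∷ xs) (suc i) = at xs i

part≡at : ∀ xs i → part xs (suc i) ≡ at xs i
part≡at []       i       = refl
part≡at (x ∷ xs) zero    = refl
part≡at (x ∷ xs) (suc i) = part≡at xs i

at-beyond : ∀ xs {i} → length xs ≤ i → at xs i ≡ 0
at-beyond []       _            = refl
at-beyond (x ∷ xs) (s≤s len≤i) = at-beyond xs len≤i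

at-++ˡ : ∀ xs ys {i} → i < length xs → at (xs ++ ys) i ≡ at xs i
at-++ˡ (x ∷ xs) ys {zero}  _         = refl
at-++ˡ (x ∷ xs) ys {suc i} (s≤s i<n) = at-++ˡ xs ys i<n

at-++ʳ : ∀ xs ys i → at (xs ++ ys) (length xs + i) ≡ at ys i
at-++ʳ []       ys i = refl
at-++ʳ (x ∷ xs) ys i = at-++ʳ xs ys i

at-take : ∀ m xs {i} → i < m → at (take m xs) i ≡ at xs i
at-take (suc m) []       _                 = refl
at-take (suc m) (x ∷ xs) {zero}  _         = refl
at-take (suc m) (x ∷ xs) {suc i} (s≤s i<m) = at-take m xs i<m

at-drop : ∀ m xs i → at (drop m xs) i ≡ at xs (m + i)
at-drop zero    xs       i = refl
at-drop (suc m) []       i = refl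
at-drop (suc m) (x ∷ xs) i = at-drop m xs i

at-map : ∀ (f : ℕ → ℕ) → f 0 ≡ 0 → ∀ xs i → at (map f xs) i ≡ f (at xs i)
at-map f f0≡0 []       i       = sym f0≡0
at-map f f0≡0 (x ∷ xs) zero    = refl
at-map f f0≡0 (x ∷ xs) (suc i) = at-map f f0≡0 xs i

at-replicate : ∀ k c {i} → i < k → at (replicate k c) i ≡ c
at-replicate (suc k) c {zero}  _         = refl
at-replicate (suc k) c {suc i} (s≤s i<k) = at-replicate k c i<k

at-map-applyUpTo : ∀ (f g : ℕ → ℕ) n {i} → i < n → at (map f (applyUpTo g n)) i ≡ f (g i)
at-map-applyUpTo f g (suc n) {zero}  _         = refl
at-map-applyUpTo f g (suc n) {suc i} (s≤s i<n) = at-map-applyUpTo f (λ x → g (suc x)) n i<n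

map-applyUpTo-const : ∀ (f g : ℕ → ℕ) n {c} → (∀ i → i < n → f (g i) ≡ c)
  → map f (applyUpTo g n) ≡ replicate n c
map-applyUpTo-const f g zero    const = refl
map-applyUpTo-const f g (suc n) const =
  cong₂ _∷_ (const 0 z<s) (map-applyUpTo-const f (λ x → g (suc x)) n (λ i i<n → const (suc i) (s<s i<n)))

-- Weakly decreasing lists, phrased through lookups (the default 0 past the
-- end keeps the condition automatic there); equivalent to the `Linked` form
-- used in `IsPartition`.
record Decreasing (xs : List ℕ) : Set where
  constructor decreasing
  field step : ∀ i → at xs (suc i) ≤ at xs i
open Decreasing public

decreasing-tail : ∀ {x xs} → Decreasing (x ∷ xs) → Decreasing xs
decreasing-tail dec = decreasing (λ i → step dec (suc i))

decreasing-antitone : ∀ {xs} → Decreasing xs → ∀ {i j} → i ≤ j → at xs j ≤ at xs i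
decreasing-antitone dec {j = zero}  z≤n   = ≤-refl
decreasing-antitone dec {i} {suc j} i≤1+j with i ≟ suc j
... | yes refl = ≤-refl
... | no  i≢   = ≤-trans (step dec j) (decreasing-antitone dec (≤-pred (≤∧≢⇒< i≤1+j i≢)))

linked⇒decreasing : ∀ {xs} → Linked (λ x y → y ≤ x) xs → Decreasing xs
linked⇒decreasing l = decreasing (linked-step l)
  where
  linked-step : ∀ {xs} → Linked (λ x y → y ≤ x) xs → ∀ i → at xs (suc i) ≤ at xs i
  linked-step []      i       = z≤n
  linked-step [-]     i       = z≤n
  linked-step (r ∷ l) zero    = r
  linked-step (r ∷ l) (suc i) = linked-step l i

decreasing⇒linked : ∀ xs → Decreasing xs → Linked (λ x y → y ≤ x) xs
decreasing⇒linked []           dec = []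
decreasing⇒linked (x ∷ [])     dec = [-]
decreasing⇒linked (x ∷ y ∷ xs) dec = step dec 0 ∷ decreasing⇒linked (y ∷ xs) (decreasing-tail dec)

-- In a decreasing list the zero parts form a tail, so discarding them
-- changes no lookup (and no sum).
at-filter-pos : ∀ {xs} → Decreasing xs → ∀ i → at (filter (0 <?_) xs) i ≡ at xs i
at-filter-pos {[]}         dec i       = refl
at-filter-pos {suc x ∷ xs} dec zero    = refl
at-filter-pos {suc x ∷ xs} dec (suc i) = at-filter-pos (decreasing-tail dec) i
at-filter-pos {zero ∷ xs}  dec i       = begin
  at (filter (0 <?_) xs) i ≡⟨ at-filter-pos (decreasing-tail dec) i ⟩
  at xs i                  ≡⟨ n≤0⇒n≡0 (decreasing-antitone dec {j = suc i} z≤n) ⟩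
  0                        ≡⟨ sym (n≤0⇒n≡0 (decreasing-antitone dec {j = i} z≤n)) ⟩
  at (zero ∷ xs) i         ∎
  where open ≡-Reasoning

filter-pos-decreasing : ∀ {xs} → Decreasing xs → Decreasing (filter (0 <?_) xs)
filter-pos-decreasing dec = decreasing λ i →
  subst₂ _≤_ (sym (at-filter-pos dec (suc i))) (sym (at-filter-pos dec i)) (step dec i)

sum-filter-pos : ∀ xs → sum (filter (0 <?_) xs) ≡ sum xs
sum-filter-pos []           = refl
sum-filter-pos (zero ∷ xs)  = sum-filter-pos xs
sum-filter-pos (suc x ∷ xs) = cong (suc x +_) (sum-filter-pos xs)

sum-replicate : ∀ k c → sum (replicate k c) ≡ k * c
sum-replicate zero    c = refl
sum-replicate (suc k) c = cong (c +_) (sum-replicate k c)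

sum-map-∸ : ∀ k xs → All (k ≤_) xs → sum (map (_∸ k) xs) + length xs * k ≡ sum xs
sum-map-∸ k []       []         = refl
sum-map-∸ k (x ∷ xs) (k≤x ∷ ks) = begin
  (x ∸ k + sum (map (_∸ k) xs)) + (k + length xs * k)
    ≡⟨ interchange (x ∸ k) _ k _ ⟩
  (x ∸ k + k) + (sum (map (_∸ k) xs) + length xs * k)
    ≡⟨ cong₂ _+_ (m∸n+n≡m k≤x) (sum-map-∸ k xs ks) ⟩
  x + sum xs ∎
  where open ≡-Reasoning

conj-∷-≤ : ∀ {x} xs {j} → j ≤ x → conj (x ∷ xs) j ≡ suc (conj xs j)
conj-∷-≤ xs j≤x = cong length (filter-accept (_ ≤?_) j≤x)

conj-∷-≰ : ∀ {x} xs {j} → ¬ j ≤ x → conj (x ∷ xs) j ≡ conj xs j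
conj-∷-≰ xs j≰x = cong length (filter-reject (_ ≤?_) j≰x)

conj-antitone : ∀ xs {j j'} → j ≤ j' → conj xs j' ≤ conj xs j
conj-antitone []       j≤j' = z≤n
conj-antitone (x ∷ xs) {j} {j'} j≤j' with j' ≤? x | j ≤? x
... | yes j'≤x | _       rewrite conj-∷-≤ xs j'≤x | conj-∷-≤ xs (≤-trans j≤j' j'≤x) =
  s≤s (conj-antitone xs j≤j')
... | no j'≰x | yes j≤x rewrite conj-∷-≰ xs j'≰x | conj-∷-≤ xs j≤x =
  m≤n⇒m≤1+n (conj-antitone xs j≤j')
... | no j'≰x | no j≰x  rewrite conj-∷-≰ xs j'≰x | conj-∷-≰ xs j≰x = conj-antitone xs j≤j'

conj-++ : ∀ xs ys j → conj (xs ++ ys) j ≡ conj xs j + conj ys j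
conj-++ []       ys j = refl
conj-++ (x ∷ xs) ys j with j ≤? x
... | yes j≤x rewrite conj-∷-≤ (xs ++ ys) j≤x | conj-∷-≤ xs j≤x = cong suc (conj-++ xs ys j)
... | no j≰x  rewrite conj-∷-≰ (xs ++ ys) j≰x | conj-∷-≰ xs j≰x = conj-++ xs ys j

conj-replicate : ∀ k {c j} → j ≤ c → conj (replicate k c) j ≡ k
conj-replicate zero        j≤c = refl
conj-replicate (suc k) {c} j≤c = trans (conj-∷-≤ (replicate k c) j≤c) (cong suc (conj-replicate k j≤c))

-- The Galois connection between a decreasing list and its conjugate:
-- j ≤ λ_{i+1} ⇔ i < λ'_j (for j ≥ 1), stated as its two directions.
<conj : ∀ {xs} → Decreasing xs → ∀ {i j} → 1 ≤ j → j ≤ at xs i → i < conj xs j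
<conj {[]}     dec         1≤j j≤0 = ⊥-elim (<⇒≱ 1≤j j≤0)
<conj {x ∷ xs} dec {zero}  1≤j j≤x = subst (0 <_) (sym (conj-∷-≤ xs j≤x)) z<s
<conj {x ∷ xs} dec {suc i} 1≤j j≤λ =
  subst (suc i <_) (sym (conj-∷-≤ xs (≤-trans j≤λ (decreasing-antitone dec {j = suc i} z≤n))))
    (s<s (<conj (decreasing-tail dec) 1≤j j≤λ))

conj≤ : ∀ {xs} → Decreasing xs → ∀ {i j} → at xs i < j → conj xs j ≤ i
conj≤ {[]}     dec λ<j = z≤n
conj≤ {x ∷ xs} dec {i} {j} λ<j with j ≤? x
conj≤ {x ∷ xs} dec {zero}  λ<j | yes j≤x = ⊥-elim (<⇒≱ λ<j j≤x)
conj≤ {x ∷ xs} dec {suc i} λ<j | yes j≤x =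
  subst (_≤ suc i) (sym (conj-∷-≤ xs j≤x)) (s≤s (conj≤ (decreasing-tail dec) λ<j))
conj≤ {x ∷ xs} dec {zero}  λ<j | no j≰x  =
  subst (_≤ 0) (sym (conj-∷-≰ xs j≰x)) (conj≤ (decreasing-tail dec) (≤-<-trans (step dec 0) λ<j))
conj≤ {x ∷ xs} dec {suc i} λ<j | no j≰x  =
  subst (_≤ suc i) (sym (conj-∷-≰ xs j≰x)) (m≤n⇒m≤1+n (conj≤ (decreasing-tail dec) λ<j))

true≢false : true ≢ false
true≢false ()

does-true⇒ : ∀ {A : Set} (a? : Dec A) → does a? ≡ true → A
does-true⇒ (yes a) _ = a

does-false⇒ : ∀ {A : Set} (a? : Dec A) → does a? ≡ false → ¬ A
does-false⇒ (no ¬a) _ = ¬a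

greatest-holds : ∀ (P : ℕ → Bool) N → 1 ≤ greatest P N → P (greatest P N) ≡ true
greatest-holds P (suc N) 1≤g with P (suc N) in eq
... | true  = eq
... | false = greatest-holds P N 1≤g

greatest-≥ : ∀ (P : ℕ → Bool) N {k} → P k ≡ true → 1 ≤ k → k ≤ N → k ≤ greatest P N
greatest-≥ P zero    Pk 1≤k k≤0 = ⊥-elim (<⇒≱ 1≤k k≤0)
greatest-≥ P (suc N) {k} Pk 1≤k k≤N with P (suc N) in eq
... | true  = k≤N
... | false with k ≟ suc N
...   | yes refl = ⊥-elim (true≢false (trans (sym Pk) eq))
...   | no  k≢   = greatest-≥ P N Pk 1≤k (≤-pred (≤∧≢⇒< k≤N k≢))

greatest-maximal : ∀ (P : ℕ → Bool) N {k} → greatest P N < k → k ≤ N → P k ≡ false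
greatest-maximal P zero    g<k k≤0 = ⊥-elim (<⇒≱ g<k k≤0)
greatest-maximal P (suc N) {k} g<k k≤N with P (suc N) in eq
... | true  = ⊥-elim (<⇒≱ g<k k≤N)
... | false with k ≟ suc N
...   | yes refl = eq
...   | no  k≢   = greatest-maximal P N g<k (≤-pred (≤∧≢⇒< k≤N k≢))

least-≥ : ∀ (P : ℕ → Bool) k f → k ≤ least P k f
least-≥ P k zero    = ≤-refl
least-≥ P k (suc f) with P k
... | true  = ≤-refl
... | false = ≤-trans (n≤1+n k) (least-≥ P (suc k) f)

least-≤ : ∀ (P : ℕ → Bool) k f {j} → k ≤ j → P j ≡ true → least P k f ≤ j
least-≤ P k zero    k≤j Pj = k≤j
least-≤ P k (suc f) {j} k≤j Pj with P k in eq
... | true  = k≤j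
... | false with k ≟ j
...   | yes refl = ⊥-elim (true≢false (trans (sym Pj) eq))
...   | no  k≢   = least-≤ P (suc k) f (≤∧≢⇒< k≤j k≢) Pj

least-holds : ∀ (P : ℕ → Bool) k f → P (k + f) ≡ true → P (least P k f) ≡ true
least-holds P k zero    Pend = subst (λ z → P z ≡ true) (+-identityʳ k) Pend
least-holds P k (suc f) Pend with P k in eq
... | true  = eq
... | false = least-holds P (suc k) f (subst (λ z → P z ≡ true) (+-suc k f) Pend)

least-minimal : ∀ (P : ℕ → Bool) k f {i} → k ≤ i → i < least P k f → P i ≡ false
least-minimal P k zero    k≤i i<l = ⊥-elim (<⇒≱ i<l k≤i)
least-minimal P k (suc f) {i} k≤i i<l with P k in eq
... | true  = ⊥-elim (<⇒≱ i<l k≤i)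
... | false with k ≟ i
...   | yes refl = eq
...   | no  k≢   = least-minimal P (suc k) f (≤∧≢⇒< k≤i k≢) i<l

-- The Durfee side D is the largest d ≤ ℓ(λ) with d ≤ λ_d; hence every
-- s ≤ D satisfies s ≤ λ_D ≤ λ_s, i.e. s ≤ λ_s.
durfee-diagonal : ∀ {la} → Decreasing la → ∀ {s'} → suc s' ≤ durfee la → suc s' ≤ at la s'
durfee-diagonal {la} dec {s'} s≤D = below-diagonal (durfee la) D≤λD s≤D
  where
  D≤λD : durfee la ≤ part la (durfee la)
  D≤λD = does-true⇒ (durfee la ≤? part la (durfee la))
           (greatest-holds _ (length la) (≤-trans (s≤s z≤n) s≤D))
  below-diagonal : ∀ d → d ≤ part la d → suc s' ≤ d → suc s' ≤ at la s'
  below-diagonal (suc d') d≤λd (s≤s s'≤d') =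
    ≤-trans (s≤s s'≤d') (≤-trans (subst (suc d' ≤_) (part≡at la d') d≤λd) (decreasing-antitone dec s'≤d'))

≤durfee : ∀ la {d} → 1 ≤ d → d ≤ length la → d ≤ part la d → d ≤ durfee la
≤durfee la 1≤d d≤ℓ d≤λd = greatest-≥ _ (length la) (dec-true (_ ≤? _) d≤λd) 1≤d d≤ℓ

smallestPart-≤ : ∀ xs {i} → i < length xs → smallestPart xs ≤ at xs i
smallestPart-≤ (x ∷ xs) {zero}  _         = foldr-⊓-≤-seed xs
  where
  foldr-⊓-≤-seed : ∀ ys → foldr _⊓_ x ys ≤ x
  foldr-⊓-≤-seed []       = ≤-refl
  foldr-⊓-≤-seed (y ∷ ys) = ≤-trans (m⊓n≤n y _) (foldr-⊓-≤-seed ys)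
smallestPart-≤ (x ∷ xs) {suc i} (s≤s i<n) = foldr-⊓-≤ xs i<n
  where
  foldr-⊓-≤ : ∀ ys {i} → i < length ys → foldr _⊓_ x ys ≤ at ys i
  foldr-⊓-≤ (y ∷ ys) {zero}  _         = m⊓n≤m y _
  foldr-⊓-≤ (y ∷ ys) {suc i} (s≤s i<n) = ≤-trans (m⊓n≤n y _) (foldr-⊓-≤ ys i<n)

smallestPart-conjugate-≤ : ∀ xs {j} → 1 ≤ j → j ≤ part xs 1 → smallestPart (conjugate xs) ≤ conj xs j
smallestPart-conjugate-≤ xs {suc j'} _ j≤λ₁ =
  subst (smallestPart (conjugate xs) ≤_) (at-map-applyUpTo (λ j → conj xs (suc j)) (λ i → i) (part xs 1) j≤λ₁)
    (smallestPart-≤ (conjugate xs) (subst (j' <_) (sym length-conjugate) j≤λ₁))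
  where
  length-conjugate : length (conjugate xs) ≡ part xs 1
  length-conjugate = trans (length-map _ (upTo (part xs 1))) (length-upTo (part xs 1))

length-take-≤ : ∀ {c} (xs : List ℕ) → c ≤ length xs → length (take c xs) ≡ c
length-take-≤ {c} xs c≤ℓ = trans (length-take c xs) (m≤n⇒m⊓n≡m c≤ℓ)

all-take : ∀ {P : ℕ → Set} c xs → (∀ {i} → i < c → P (at xs i)) → All P (take c xs)
all-take zero    xs       _ = []
all-take (suc c) []       _ = []
all-take (suc c) (x ∷ xs) h = h z<s ∷ all-take c xs (λ i<c → h (s<s i<c))

shave : ℕ → ℕ → List ℕ → List ℕ
shave k c xs = map (_∸ k) (take c xs) ++ drop c xs

module _ (k : ℕ) {c : ℕ} (xs : List ℕ) (c≤ℓ : c ≤ length xs) where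

  length-shaved : length (map (_∸ k) (take c xs)) ≡ c
  length-shaved = trans (length-map (_∸ k) (take c xs)) (length-take-≤ xs c≤ℓ)

  at-shave-< : ∀ {i} → i < c → at (shave k c xs) i ≡ at xs i ∸ k
  at-shave-< {i} i<c = begin
    at (shave k c xs) i           ≡⟨ at-++ˡ (map (_∸ k) (take c xs)) (drop c xs) (subst (i <_) (sym length-shaved) i<c) ⟩
    at (map (_∸ k) (take c xs)) i ≡⟨ at-map (_∸ k) (0∸n≡0 k) (take c xs) i ⟩
    at (take c xs) i ∸ k          ≡⟨ cong (_∸ k) (at-take c xs i<c) ⟩
    at xs i ∸ k                   ∎
    where open ≡-Reasoning

  at-shave-≥ : ∀ {i} → c ≤ i → at (shave k c xs) i ≡ at xs i
  at-shave-≥ {i} c≤i = begin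
    at (shave k c xs) i           ≡⟨ cong (at (shave k c xs)) (sym i≡c+j) ⟩
    at (shave k c xs) (c + j)     ≡⟨ cong (λ z → at (shave k c xs) (z + j)) (sym length-shaved) ⟩
    at (shave k c xs) (length (map (_∸ k) (take c xs)) + j) ≡⟨ at-++ʳ (map (_∸ k) (take c xs)) (drop c xs) j ⟩
    at (drop c xs) j              ≡⟨ at-drop c xs j ⟩
    at xs (c + j)                 ≡⟨ cong (at xs) i≡c+j ⟩
    at xs i                       ∎
    where
    open ≡-Reasoning
    j = i ∸ c
    i≡c+j : c + j ≡ i
    i≡c+j = m+[n∸m]≡n c≤i

  module _ (shaveable : ∀ {i} → i < c → at xs c + k ≤ at xs i) where

    shave-decreasing : Decreasing xs → Decreasing (shave k c xs)
    shave-decreasing dec = decreasing shave-step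
      where
      shave-step : ∀ i → at (shave k c xs) (suc i) ≤ at (shave k c xs) i
      shave-step i with suc i <? c | i <? c
      ... | yes 1+i<c | _ =
        subst₂ _≤_ (sym (at-shave-< 1+i<c)) (sym (at-shave-< (<-trans (n<1+n i) 1+i<c)))
          (∸-monoˡ-≤ k (step dec i))
      ... | no 1+i≮c | yes i<c =
        subst₂ _≤_ (sym (at-shave-≥ (≮⇒≥ 1+i≮c))) (sym (at-shave-< i<c))
          (≤-trans (decreasing-antitone dec (≮⇒≥ 1+i≮c)) (m+n≤o⇒m≤o∸n _ (shaveable i<c)))
      ... | no _ | no i≮c =
        subst₂ _≤_ (sym (at-shave-≥ (≤-trans (≮⇒≥ i≮c) (n≤1+n i)))) (sym (at-shave-≥ (≮⇒≥ i≮c)))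
          (step dec i)

    sum-shave : sum (shave k c xs) + c * k ≡ sum xs
    sum-shave = begin
      sum (map (_∸ k) T ++ D) + c * k        ≡⟨ cong (_+ c * k) (sum-++ (map (_∸ k) T) D) ⟩
      sum (map (_∸ k) T) + sum D + c * k     ≡⟨ xy∙z≈xz∙y (sum (map (_∸ k) T)) (sum D) (c * k) ⟩
      sum (map (_∸ k) T) + c * k + sum D     ≡⟨ cong (λ z → sum (map (_∸ k) T) + z * k + sum D) (sym (length-take-≤ xs c≤ℓ)) ⟩
      sum (map (_∸ k) T) + length T * k + sum D
        ≡⟨ cong (_+ sum D) (sum-map-∸ k T (all-take c xs (λ i<c → ≤-trans (m≤n+m k _) (shaveable i<c)))) ⟩
      sum T + sum D                          ≡⟨ sym (sum-++ T D) ⟩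
      sum (T ++ D)                           ≡⟨ cong sum (take++drop≡id c xs) ⟩
      sum xs                                 ∎
      where
      open ≡-Reasoning
      T = take c xs
      D = drop c xs

insertBlock : ℕ → ℕ → ℕ → List ℕ → List ℕ
insertBlock m k c xs = take m xs ++ replicate k c ++ drop m xs

module _ {m : ℕ} (k c : ℕ) (xs : List ℕ) (m≤ℓ : m ≤ length xs) where

  private
    at-insert-from : ∀ j → at (insertBlock m k c xs) (m + j) ≡ at (replicate k c ++ drop m xs) j
    at-insert-from j =
      subst (λ z → at (insertBlock m k c xs) (z + j) ≡ at (replicate k c ++ drop m xs) j) (length-take-≤ xs m≤ℓ)
        (at-++ʳ (take m xs) (replicate k c ++ drop m xs) j)

  at-insert-< : ∀ {i} → i < m → at (insertBlock m k c xs) i ≡ at xs i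
  at-insert-< {i} i<m =
    trans (at-++ˡ (take m xs) _ (subst (i <_) (sym (length-take-≤ xs m≤ℓ)) i<m)) (at-take m xs i<m)

  at-insert-block : ∀ {i} → m ≤ i → i < m + k → at (insertBlock m k c xs) i ≡ c
  at-insert-block {i} m≤i i<m+k = begin
    at (insertBlock m k c xs) i           ≡⟨ cong (at (insertBlock m k c xs)) (sym (m+[n∸m]≡n m≤i)) ⟩
    at (insertBlock m k c xs) (m + j)     ≡⟨ at-insert-from j ⟩
    at (replicate k c ++ drop m xs) j     ≡⟨ at-++ˡ (replicate k c) (drop m xs) (subst (j <_) (sym (length-replicate k)) j<k) ⟩
    at (replicate k c) j                  ≡⟨ at-replicate k c j<k ⟩
    c                                     ∎
    where
    open ≡-Reasoning
    j = i ∸ m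
    j<k : j < k
    j<k = +-cancelˡ-< m j k (subst (_< m + k) (sym (m+[n∸m]≡n m≤i)) i<m+k)

  at-insert-> : ∀ {i} → m + k ≤ i → at (insertBlock m k c xs) i ≡ at xs (i ∸ k)
  at-insert-> {i} m+k≤i = begin
    at (insertBlock m k c xs) i                   ≡⟨ cong (at (insertBlock m k c xs)) (sym i≡) ⟩
    at (insertBlock m k c xs) (m + (k + j))       ≡⟨ at-insert-from (k + j) ⟩
    at (replicate k c ++ drop m xs) (k + j)       ≡⟨ cong (λ z → at (replicate k c ++ drop m xs) (z + j)) (sym (length-replicate k)) ⟩
    at (replicate k c ++ drop m xs) (length (replicate k c) + j) ≡⟨ at-++ʳ (replicate k c) (drop m xs) j ⟩
    at (drop m xs) j                              ≡⟨ at-drop m xs j ⟩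
    at xs (m + j)                                 ≡⟨ cong (at xs) (m+[n∸m]≡n m≤i') ⟩
    at xs i'                                      ∎
    where
    open ≡-Reasoning
    i' = i ∸ k
    j = i' ∸ m
    m≤i' : m ≤ i'
    m≤i' = m+n≤o⇒m≤o∸n m m+k≤i
    i≡ : m + (k + j) ≡ i
    i≡ = begin
      m + (k + j)   ≡⟨ x∙yz≈y∙xz m k j ⟩
      k + (m + j)   ≡⟨ cong (k +_) (m+[n∸m]≡n m≤i') ⟩
      k + i'        ≡⟨ m+[n∸m]≡n (≤-trans (m≤n+m k m) m+k≤i) ⟩
      i             ∎

  insertBlock-decreasing : Decreasing xs → (∀ {i} → i < m → c ≤ at xs i) → at xs m ≤ c
    → Decreasing (insertBlock m k c xs)
  insertBlock-decreasing dec c≤before after≤c = decreasing insert-step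
    where
    μ = insertBlock m k c xs

    ≤c : ∀ {i} → m ≤ i → at μ i ≤ c
    ≤c {i} m≤i with i <? m + k
    ... | yes i<m+k = ≤-reflexive (at-insert-block m≤i i<m+k)
    ... | no  i≮m+k = subst (_≤ c) (sym (at-insert-> (≮⇒≥ i≮m+k)))
      (≤-trans (decreasing-antitone dec (m+n≤o⇒m≤o∸n m (≮⇒≥ i≮m+k))) after≤c)

    c≤ : ∀ {i} → i < m + k → c ≤ at μ i
    c≤ {i} i<m+k with i <? m
    ... | yes i<m = subst (c ≤_) (sym (at-insert-< i<m)) (c≤before i<m)
    ... | no  i≮m = ≤-reflexive (sym (at-insert-block (≮⇒≥ i≮m) i<m+k))

    insert-step : ∀ i → at μ (suc i) ≤ at μ i
    insert-step i with suc i <? m | i <? m + k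
    ... | yes 1+i<m | _ =
      subst₂ _≤_ (sym (at-insert-< 1+i<m)) (sym (at-insert-< (<-trans (n<1+n i) 1+i<m))) (step dec i)
    ... | no 1+i≮m | yes i<m+k = ≤-trans (≤c (≮⇒≥ 1+i≮m)) (c≤ i<m+k)
    ... | no _ | no i≮m+k = subst₂ _≤_ (sym after-next) (sym (at-insert-> (≮⇒≥ i≮m+k))) (step dec (i ∸ k))
      where
      after-next : at μ (suc i) ≡ at xs (suc (i ∸ k))
      after-next = trans (at-insert-> (≤-trans (≮⇒≥ i≮m+k) (n≤1+n i)))
        (cong (at xs) (+-∸-assoc 1 (≤-trans (m≤n+m k m) (≮⇒≥ i≮m+k))))

  length-insertBlock : m + k ≤ length (insertBlock m k c xs)
  length-insertBlock = subst (m + k ≤_) (sym length≡) (+-monoʳ-≤ m (m≤m+n k _))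
    where
    length≡ : length (insertBlock m k c xs) ≡ m + (k + length (drop m xs))
    length≡ = trans (length-++ (take m xs))
      (cong₂ _+_ (length-take-≤ xs m≤ℓ) (trans (length-++ (replicate k c)) (cong (_+ _) (length-replicate k))))

insertBlock-positive : ∀ m k {c} xs → 0 < c → All (0 <_) xs → All (0 <_) (insertBlock m k c xs)
insertBlock-positive m k xs 0<c pos =
  All.++⁺ (All.take⁺ m pos) (All.++⁺ (All.replicate⁺ k 0<c) (All.drop⁺ m pos))

sum-insertBlock : ∀ m k c xs → sum (insertBlock m k c xs) ≡ sum xs + k * c
sum-insertBlock m k c xs = begin
  sum (take m xs ++ replicate k c ++ drop m xs)        ≡⟨ sum-++ (take m xs) _ ⟩
  sum (take m xs) + sum (replicate k c ++ drop m xs)   ≡⟨ cong (sum (take m xs) +_) (sum-++ (replicate k c) _) ⟩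
  sum (take m xs) + (sum (replicate k c) + sum (drop m xs))
    ≡⟨ cong (λ z → sum (take m xs) + (z + sum (drop m xs))) (sum-replicate k c) ⟩
  sum (take m xs) + (k * c + sum (drop m xs))          ≡⟨ x∙yz≈xz∙y (sum (take m xs)) (k * c) _ ⟩
  sum (take m xs) + sum (drop m xs) + k * c            ≡⟨ cong (_+ k * c) (sym (sum-++ (take m xs) (drop m xs))) ⟩
  sum (take m xs ++ drop m xs) + k * c                 ≡⟨ cong (λ z → sum z + k * c) (take++drop≡id m xs) ⟩
  sum xs + k * c                                       ∎
  where open ≡-Reasoning

-- The head can only grow: either it is untouched or it becomes c ≥ xs_0.
insertBlock-head : ∀ m k c xs → 1 ≤ k → at xs m ≤ c → at xs 0 ≤ at (insertBlock m k c xs) 0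
insertBlock-head zero    (suc k) c xs       _ xs₀≤c = xs₀≤c
insertBlock-head (suc m) k       c []       _ _     = z≤n
insertBlock-head (suc m) k       c (x ∷ xs) _ _     = ≤-refl

-- Positions are one-indexed in `part` but zero-indexed in `at`.
suc-∸1 : ∀ {n} → 1 ≤ n → suc (n ∸ 1) ≡ n
suc-∸1 (s≤s _) = refl

firstBelow : List ℕ → ℕ → ℕ
firstBelow xs c = least (λ j → does (part xs j <? c)) 1 (length xs + 1)

module _ (xs : List ℕ) (c : ℕ) where

  private
    Below : ℕ → Bool
    Below j = does (part xs j <? c)

  firstBelow-pos : 1 ≤ firstBelow xs c
  firstBelow-pos = least-≥ Below 1 (length xs + 1)

  firstBelow-≤ : ∀ {i} → at xs i < c → firstBelow xs c ≤ suc i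
  firstBelow-≤ {i} xsᵢ<c = least-≤ Below 1 (length xs + 1) (s≤s z≤n)
    (dec-true (part xs (suc i) <? c) (subst (_< c) (sym (part≡at xs i)) xsᵢ<c))

  firstBelow-before : ∀ {i} → suc i < firstBelow xs c → c ≤ at xs i
  firstBelow-before {i} i<a = subst (c ≤_) (part≡at xs i)
    (≮⇒≥ (does-false⇒ (part xs (suc i) <? c) (least-minimal Below 1 (length xs + 1) (s≤s z≤n) i<a)))

  module _ (1≤c : 1 ≤ c) where

    private
      below-beyond : ∀ {i} → length xs ≤ i → at xs i < c
      below-beyond ℓ≤i = subst (_< c) (sym (at-beyond xs ℓ≤i)) 1≤c

    firstBelow-≤-length : firstBelow xs c ≤ suc (length xs)
    firstBelow-≤-length = firstBelow-≤ (below-beyond ≤-refl)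

    firstBelow-drops : at xs (firstBelow xs c ∸ 1) < c
    firstBelow-drops = subst (_< c) (trans (cong (part xs) (sym (suc-∸1 firstBelow-pos))) (part≡at xs _))
      (does-true⇒ (part xs (firstBelow xs c) <? c)
        (least-holds Below 1 (length xs + 1)
          (dec-true (part xs (suc (length xs + 1)) <? c)
            (subst (_< c) (sym (part≡at xs (length xs + 1))) (below-beyond (m≤m+n (length xs) 1))))))

-- A block of k ≥ 1 parts equal to c on top of a decreasing list with all
-- parts below c: column c of the result has length exactly k, while every
-- column b ≤ xs₀ is strictly longer; so λ'_b exceeds the smallest column.
front-block-conj : ∀ {xs} k {c b} → Decreasing xs → at xs 0 < c → 1 ≤ k → 1 ≤ b → b ≤ at xs 0
  → smallestPart (conjugate (replicate k c ++ xs)) < conj (replicate k c ++ xs) b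
front-block-conj {xs} k {c} {b} dec xs₀<c 1≤k 1≤b b≤xs₀ = begin-strict
  smallestPart (conjugate ν) ≤⟨ smallestPart-conjugate-≤ ν (≤-trans 1≤b b≤c) c≤ν₁ ⟩
  conj ν c                   ≡⟨ conj-++ (replicate k c) xs c ⟩
  conj (replicate k c) c + conj xs c ≡⟨ cong₂ _+_ (conj-replicate k ≤-refl) (n≤0⇒n≡0 (conj≤ dec xs₀<c)) ⟩
  k + 0                      <⟨ +-monoʳ-< k (<conj dec 1≤b b≤xs₀) ⟩
  k + conj xs b              ≡⟨ cong (_+ conj xs b) (sym (conj-replicate k b≤c)) ⟩
  conj (replicate k c) b + conj xs b ≡⟨ sym (conj-++ (replicate k c) xs b) ⟩
  conj ν b                   ∎
  where
  open ≤-Reasoning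
  ν = replicate k c ++ xs
  b≤c : b ≤ c
  b≤c = <⇒≤ (≤-<-trans b≤xs₀ xs₀<c)
  c≤ν₁ : c ≤ part ν 1
  c≤ν₁ = ≤-reflexive (sym (trans (part≡at ν 0)
    (trans (at-++ˡ (replicate k c) xs (subst (0 <_) (sym (length-replicate k)) 1≤k)) (at-replicate k c 1≤k))))

∸-∸-shift : ∀ {t m n} → n ≤ m → m ≤ t → t ∸ (m ∸ n) ≡ t ∸ m + n
∸-∸-shift {t} {m} {n} n≤m m≤t = begin
  t ∸ (m ∸ n)             ≡⟨ cong (_∸ (m ∸ n)) (sym (m∸n+n≡m m≤t)) ⟩
  (t ∸ m + m) ∸ (m ∸ n)   ≡⟨ +-∸-assoc (t ∸ m) (m∸n≤m m n) ⟩
  t ∸ m + (m ∸ (m ∸ n))   ≡⟨ cong (t ∸ m +_) (m∸[m∸n]≡n n≤m) ⟩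
  t ∸ m + n               ∎
  where open ≡-Reasoning

module TauConstruction (la : List ℕ) (s' : ℕ) (la-partition : IsPartition la)
                       (s≤D : suc s' ≤ durfee la) where

  s : ℕ
  s = suc s'

  la-decreasing : Decreasing la
  la-decreasing = linked⇒decreasing (proj₂ la-partition)

  -- c = λ'_s.  Since λ_s ≥ s (Durfee), c ≥ s; by the Galois connection
  -- λ_c ≥ s > λ_{c+1} (one-indexed).
  c : ℕ
  c = conj la s

  s≤c : s ≤ c
  s≤c = <conj la-decreasing (s≤s z≤n) (durfee-diagonal la-decreasing s≤D)

  1≤c : 1 ≤ c
  1≤c = ≤-trans (s≤s z≤n) s≤c

  c' : ℕ
  c' = c ∸ 1

  1+c'≡c : suc c' ≡ c
  1+c'≡c = suc-∸1 1≤c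

  λ-after-c<s : at la c < s
  λ-after-c<s = ≰⇒> λ s≤λ → <-irrefl refl (<conj la-decreasing (s≤s z≤n) s≤λ)

  c≤ℓ : c ≤ length la
  c≤ℓ = conj≤ la-decreasing (subst (_< s) (sym (at-beyond la ≤-refl)) z<s)

  λ₁ : ℕ
  λ₁ = part la 1

  p : ℕ
  p = tau-p la s

  s≤p : s ≤ p
  s≤p = greatest-≥ _ λ₁ (dec-true (c ≟ c) refl) (s≤s z≤n)
    (subst (s ≤_) (sym (part≡at la 0)) (≤-trans (durfee-diagonal la-decreasing s≤D) (decreasing-antitone la-decreasing z≤n)))

  conj-p : conj la p ≡ c
  conj-p = does-true⇒ (conj la p ≟ c) (greatest-holds _ λ₁ (≤-trans (s≤s z≤n) s≤p))

  λc≡p : at la c' ≡ p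
  λc≡p = ≤-antisym λc≤p p≤λc
    where
    p≤λc : p ≤ at la c'
    p≤λc = ≮⇒≥ λ λc<p → <-irrefl refl (subst (_≤ c') (trans conj-p (sym 1+c'≡c)) (conj≤ la-decreasing λc<p))
    λc≤p : at la c' ≤ p
    λc≤p = ≮⇒≥ λ p<λc → does-false⇒ (conj la (suc p) ≟ c)
      (greatest-maximal _ λ₁ ≤-refl (subst (suc p ≤_) (sym (part≡at la 0)) (≤-trans p<λc (decreasing-antitone la-decreasing z≤n))))
      (≤-antisym (subst (conj la (suc p) ≤_) conj-p (conj-antitone la (n≤1+n p)))
                 (subst (_≤ conj la (suc p)) 1+c'≡c (<conj la-decreasing (s≤s z≤n) p<λc)))

  conj-constant : ∀ {j} → s ≤ j → j ≤ p → conj la j ≡ c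
  conj-constant s≤j j≤p = ≤-antisym (conj-antitone la s≤j) (subst (_≤ conj la _) conj-p (conj-antitone la j≤p))

  k : ℕ
  k = p ∸ s + 1

  k≡p∸s' : k ≡ p ∸ s'
  k≡p∸s' = trans (+-comm (p ∸ s) 1) (sym (+-∸-assoc 1 s≤p))

  1≤k : 1 ≤ k
  1≤k = subst (1 ≤_) (+-comm 1 (p ∸ s)) (s≤s z≤n)

  λc∸k≡s' : at la c' ∸ k ≡ s'
  λc∸k≡s' = trans (cong₂ _∸_ λc≡p k≡p∸s') (m∸[m∸n]≡n (≤-trans (n≤1+n s') s≤p))

  δ : List ℕ
  δ = tau-δ la s

  shaveable : ∀ {i} → i < c → at la c + k ≤ at la i
  shaveable {i} i<c = begin
    at la c + k  ≤⟨ +-monoˡ-≤ k (≤-pred λ-after-c<s) ⟩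
    s' + k       ≡⟨ cong (s' +_) k≡p∸s' ⟩
    s' + (p ∸ s') ≡⟨ m+[n∸m]≡n (≤-trans (n≤1+n s') s≤p) ⟩
    p            ≡⟨ sym λc≡p ⟩
    at la c'     ≤⟨ decreasing-antitone la-decreasing (≤-pred (subst (suc i ≤_) (sym 1+c'≡c) i<c)) ⟩
    at la i      ∎
    where open ≤-Reasoning

  δ-decreasing : Decreasing δ
  δ-decreasing = filter-pos-decreasing (shave-decreasing k la c≤ℓ shaveable la-decreasing)

  δ-positive : All (0 <_) δ
  δ-positive = All.all-filter (0 <?_) (shave k c la)

  sum-δ : sum δ + c * k ≡ sum la
  sum-δ = trans (cong (_+ c * k) (sum-filter-pos (shave k c la))) (sum-shave k la c≤ℓ shaveable)

  at-δ-< : ∀ {i} → i < c → at δ i ≡ at la i ∸ k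
  at-δ-< {i} i<c = trans (at-filter-pos (shave-decreasing k la c≤ℓ shaveable la-decreasing) i) (at-shave-< k la c≤ℓ i<c)

  δc≡s' : at δ c' ≡ s'
  δc≡s' = trans (at-δ-< (subst (c' <_) 1+c'≡c ≤-refl)) λc∸k≡s'

  s'≤δ₀ : s' ≤ at δ 0
  s'≤δ₀ = subst (_≤ at δ 0) δc≡s' (decreasing-antitone δ-decreasing z≤n)

  a : ℕ
  a = tau-a la s

  m : ℕ
  m = a ∸ 1

  1+m≡a : suc m ≡ a
  1+m≡a = suc-∸1 (firstBelow-pos δ c)

  δm<c : at δ m < c
  δm<c = firstBelow-drops δ c 1≤c

  c≤δ-before : ∀ {i} → i < m → c ≤ at δ i
  c≤δ-before i<m = firstBelow-before δ c (subst (_ <_) 1+m≡a (s<s i<m))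

  a≤c : a ≤ c
  a≤c = subst (a ≤_) 1+c'≡c (firstBelow-≤ δ c (subst (_< c) (sym δc≡s') s≤c))

  m≤ℓδ : m ≤ length δ
  m≤ℓδ = ≤-pred (subst (_≤ suc (length δ)) (sym 1+m≡a) (firstBelow-≤-length δ c 1≤c))

  μ : List ℕ
  μ = insertBlock m k c δ

  tau-μ≡μ : tau-μ la s ≡ μ
  tau-μ≡μ = cong (λ block → take m δ ++ block ++ drop m δ)
    (map-applyUpTo-const (λ j → conj la (s + j)) (λ j → j) k
      (λ i i<k → conj-constant (m≤m+n s i) (s+i≤p i<k)))
    where
    s+i≤p : ∀ {i} → i < k → s + i ≤ p
    s+i≤p {i} i<k = subst (s + i ≤_) (m+[n∸m]≡n s≤p)
      (+-monoʳ-≤ s (≤-pred (subst (suc i ≤_) (+-comm (p ∸ s) 1) i<k)))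

  μ-partition : IsPartition μ
  μ-partition = insertBlock-positive m k δ 1≤c δ-positive
              , decreasing⇒linked μ (insertBlock-decreasing k c δ m≤ℓδ δ-decreasing c≤δ-before (<⇒≤ δm<c))

  size-μ : size μ ≡ size la
  size-μ = begin
    sum μ         ≡⟨ sum-insertBlock m k c δ ⟩
    sum δ + k * c ≡⟨ cong (sum δ +_) (*-comm k c) ⟩
    sum δ + c * k ≡⟨ sum-δ ⟩
    sum la        ∎
    where open ≡-Reasoning

  μ-at-m : at μ m ≡ c
  μ-at-m = at-insert-block k c δ m≤ℓδ ≤-refl (m<m+n m 1≤k)

  a≤durfee-μ : a ≤ durfee μ
  a≤durfee-μ = ≤durfee μ (firstBelow-pos δ c)
    (subst (_≤ length μ) (trans (+-comm m 1) 1+m≡a) (≤-trans (+-monoʳ-≤ m 1≤k) (length-insertBlock k c δ m≤ℓδ)))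
    (subst (a ≤_) (sym (trans (cong (part μ) (sym 1+m≡a)) (trans (part≡at μ m) μ-at-m))) a≤c)

  δ₀≤μ₀ : at δ 0 ≤ at μ 0
  δ₀≤μ₀ = insertBlock-head m k c δ 1≤k (<⇒≤ δm<c)

  module Marks (t : ℕ) (1≤t : 1 ≤ t) (t≤λ₁ : t ≤ λ₁)
               (not-doubly-marked : s ≤ t → conj la s ≡ conj la t → ⊥) where

    b : ℕ
    b = tau-b la s t

    b-range : 1 ≤ b × b ≤ at δ 0
    b-range with t <? s
    ... | yes t<s = subst (λ z → 1 ≤ z × z ≤ at δ 0) (sym b≡t) (1≤t , ≤-trans (≤-pred t<s) s'≤δ₀)
      where
      b≡t : b ≡ t
      b≡t = cong (λ β → if β then t else t ∸ p + s ∸ 1) (dec-true (t <? s) t<s)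
    ... | no t≮s = subst (λ z → 1 ≤ z × z ≤ at δ 0) (sym b≡t∸k) (1≤t∸k , t∸k≤δ₀)
      where
      s≤t : s ≤ t
      s≤t = ≮⇒≥ t≮s
      p<t : p < t
      p<t = ≰⇒> λ t≤p → not-doubly-marked s≤t (sym (conj-constant s≤t t≤p))
      t∸k≡ : t ∸ k ≡ t ∸ p + s'
      t∸k≡ = trans (cong (t ∸_) k≡p∸s') (∸-∸-shift (≤-trans (n≤1+n s') s≤p) (<⇒≤ p<t))
      b≡t∸k : b ≡ t ∸ k
      b≡t∸k = begin
        b                   ≡⟨ cong (λ β → if β then t else t ∸ p + s ∸ 1) (dec-false (t <? s) t≮s) ⟩
        t ∸ p + suc s' ∸ 1  ≡⟨ cong (_∸ 1) (+-suc (t ∸ p) s') ⟩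
        t ∸ p + s'          ≡⟨ sym t∸k≡ ⟩
        t ∸ k               ∎
        where open ≡-Reasoning
      1≤t∸k : 1 ≤ t ∸ k
      1≤t∸k = subst (1 ≤_) (sym t∸k≡) (≤-trans (m<n⇒0<n∸m p<t) (m≤m+n (t ∸ p) s'))
      t∸k≤δ₀ : t ∸ k ≤ at δ 0
      t∸k≤δ₀ = subst (t ∸ k ≤_) (sym (at-δ-< 1≤c)) (∸-monoˡ-≤ k (subst (t ≤_) (part≡at la 0) t≤λ₁))

    b≤μ₁ : b ≤ part μ 1
    b≤μ₁ = subst (b ≤_) (sym (part≡at μ 0)) (≤-trans (proj₂ b-range) δ₀≤μ₀)

    -- When a = 1 the block sits on top of δ, whose parts are all below c.
    a≡1⇒conj-b-large : a ≡ 1 → smallestPart (conjugate (tau-μ la s)) < conj (tau-μ la s) b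
    a≡1⇒conj-b-large a≡1 =
      subst (λ ν → smallestPart (conjugate ν) < conj ν b) (sym (trans tau-μ≡μ μ≡block++δ))
        (front-block-conj k δ-decreasing δ₀<c 1≤k (proj₁ b-range) (proj₂ b-range))
      where
      m≡0 : m ≡ 0
      m≡0 = cong (_∸ 1) a≡1
      μ≡block++δ : μ ≡ replicate k c ++ δ
      μ≡block++δ = cong (λ i → insertBlock i k c δ) m≡0
      δ₀<c : at δ 0 < c
      δ₀<c = subst (λ i → at δ i < c) m≡0 δm<c

lemma3p2 : (n : ℕ) → 1 ≤ n → (la : List ℕ) → (s t : ℕ)
    → InU n la s t → ¬ InQ n la s t
    → InU n (tau-μ la s) (tau-a la s) (tau-b la s t)
      × (tau-a la s ≡ 1 → conj (tau-μ la s) (tau-b la s t) > smallestPart (conjugate (tau-μ la s)))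
lemma3p2 n _ la zero      t (_ , _ , () , _) _
lemma3p2 n _ la (suc s') t u@(la-partition , size≡n , _ , s≤D , 1≤t , t≤λ₁) not-in-Q =
  subst (λ ν → InU n ν a b) (sym tau-μ≡μ)
    (μ-partition , trans size-μ size≡n , firstBelow-pos δ c , a≤durfee-μ , proj₁ b-range , b≤μ₁)
  , a≡1⇒conj-b-large
  where
  open TauConstruction la s' la-partition s≤D
  open Marks t 1≤t t≤λ₁ (λ s≤t same-length → not-in-Q (u , s≤t , same-length))
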